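{- For all natural numbers $m,n$, every list $O$ of oracles and every list $R$ of comparator networks, if $\mathrm{GP}(m,n,O)=\mathsf{no}(m,n,R)$, then every sorting network on $m$ channels has size strictly greater than $n$.
   Context: A comparator is a pair $(i,j)$ of natural numbers; a comparator network is a finite list of comparators, and its size is the number of comparators. $C_1;C_2$ denotes concatenation. A network is a network on $n$ channels if every comparator $(i,j)$ has $i<n$, $j<n$, $i\neq j$; it is standard on $n$ channels if every comparator has $i<j<n$. For $\vec x=(x_0,\ldots,x_{n-1})\in\{0,1\}^n$, applying comparator $(i,j)$ leaves $\vec x$ unchanged if $x_i\le x_j$ and otherwise swaps the entries at positions $i$ and $j$; $C(\vec x)$ applies the comparators of $C$ in order; $\mathsf{outputs}(C)=\{C(\vec x):\vec x\in\{0,1\}^n\}$. $C$ is a sorting network on $n$ channels if it is a network on $n$ channels and $C(\vec x)$ is nondecreasing for all $\vec x\in\{0,1\}^n$. A comparator $c=(i,j)$ is redundant after $C_1$ if $C_1(\vec x)_i\le C_1(\vec x)_j$ for all $\vec x\in\{0,1\}^n$. $\mathrm{OGenerate}(R,n)$ is the list of all $C;(i,j)$ with $C\in R$, $i<j<n$, and $(i,j)$ not redundant after $C$. An oracle is a finite list of triples $(C,C',\pi)$ with $C,C'$ networks and $\pi$ a finite list of naturals. A list $\pi=[\pi_0,\ldots,\pi_{m'-1}]$ represents a permutation of $\{0,\ldots,n-1\}$ if $m'=n$, all $\pi_i<n$ and they are pairwise distinct; then $\pi(\vec x)=\vec y$ with $y_{\pi_i}=x_i$, and $C\le_\pi C'$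 means $\{\pi(\vec x):\vec x\in\mathsf{outputs}(C)\}\subseteq\mathsf{outputs}(C')$. $\mathrm{Prune}(X,R,n)$: if $X$ is empty return $R$; if $X=(C,C',\pi)::X'$, then if $C=C'$, or $C\notin R$, or $\pi$ does not represent a permutation of $\{0,\ldots,n-1\}$, or not $C\le_\pi C'$, return $R$; otherwise return $\mathrm{Prune}(X',R\setminus C',n)$ ($R$ with all occurrences of $C'$ removed). The procedure $\mathrm{GP}(m,n,O)$, with $O$ a list of oracles, returns one of $\mathsf{yes}(p,q)$, $\mathsf{no}(p,q,R)$ ($R$ a list of networks), or $\mathsf{maybe}$, and is defined by recursion on $n$: $\mathrm{GP}(m,0,O)$ is $\mathsf{yes}(0,0)$ if $m=0$, $\mathsf{yes}(1,0)$ if $m=1$, and $\mathsf{no}(m,0,[\emptyset])$ otherwise (where $\emptyset$ is the empty network). $\mathrm{GP}(m,n+1,O)$ is $\mathsf{maybe}$ if $O$ is empty; if $O=X::O'$, let $G=\mathrm{GP}(m,n,O')$: if $G=\mathsf{maybe}$ return $\mathsf{maybe}$; if $G=\mathsf{yes}(p,q)$ return $\mathsf{yes}(p,q)$; if $G=\mathsf{no}(p,q,R)$, let $R'=\mathrm{Prune}(X,\mathrm{OGenerate}(R,p),p)$, and return $\mathsf{yes}(p,q+1)$ if some element of $R'$ is a sorting network on $p$ channels, and $\mathsf{no}(p,q+1,R')$ otherwise. -}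

module Defs where

open import Data.Nat using (ℕ; zero; suc; _<_; _<ᵇ_; _≡ᵇ_; _+_)
open import Data.Nat.Properties using () renaming (_≟_ to _≟ℕ_)
open import Data.Bool using (Bool; true; false; _∧_; _∨_; not; if_then_else_) renaming (_≤_ to _≤B_)
open import Data.Bool.Properties using () renaming (_≟_ to _≟B_)
open import Data.List using (List; []; _∷_; _++_; [_]; map; concatMap; filter; length; upTo)
open import Data.Bool.ListAction using (all; any)
open import Data.List.Properties using (≡-dec)
open import Data.List.Relation.Unary.All using (All)
open import Data.List.Relation.Unary.Linked using (Linked)
open import Data.Product using (_×_; _,_)
open import Data.Product.Properties using () renaming (≡-dec to ×-≡-dec)
open import Relation.Nullary using (¬_; does; ¬?)
open import Relation.Nullary.Decidable.Core using (T?)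
open import Relation.Binary.PropositionalEquality using (_≡_; _≢_)

Comparator : Set
Comparator = ℕ × ℕ

Network : Set
Network = List Comparator

size : Network → ℕ
size = length

Oracle : Set
Oracle = List (Network × Network × List ℕ)

-- Binary inputs are lists of booleans (false = 0, true = 1).

lookupD : List Bool → ℕ → Bool
lookupD []       _       = false
lookupD (x ∷ xs) zero    = x
lookupD (x ∷ xs) (suc i) = lookupD xs i

update : List Bool → ℕ → Bool → List Bool
update []       _       _ = []
update (x ∷ xs) zero    b = b ∷ xs
update (x ∷ xs) (suc i) b = x ∷ update xs i b

leqB : Bool → Bool → Bool
leqB true false = false
leqB _    _     = true

-- Convention (irrelevant for networks on n channels): a comparator with an
-- out-of-range channel leaves the input unchanged.
applyComp : Comparator → List Bool → List Bool
applyComp (i , j) x =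
  if (i <ᵇ length x) ∧ (j <ᵇ length x)
  then (if leqB (lookupD x i) (lookupD x j)
        then x
        else update (update x i (lookupD x j)) j (lookupD x i))
  else x

run : Network → List Bool → List Bool
run []      x = x
run (c ∷ C) x = run C (applyComp c x)

inputs : ℕ → List (List Bool)
inputs zero    = [] ∷ []
inputs (suc n) = map (false ∷_) (inputs n) ++ map (true ∷_) (inputs n)

outputs : ℕ → Network → List (List Bool)
outputs n C = map (run C) (inputs n)

OnChannels : ℕ → Network → Set
OnChannels n C = All (λ { (i , j) → i < n × j < n × i ≢ j }) C

SortingNetwork : ℕ → Network → Set
SortingNetwork n C =
  OnChannels n C × ((x : List Bool) → length x ≡ n → Linked _≤B_ (run C x))

onChannelsB : ℕ → Network → Bool
onChannelsB n C = all (λ { (i , j) → (i <ᵇ n) ∧ (j <ᵇ n) ∧ not (i ≡ᵇ j) }) C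

sortedB : List Bool → Bool
sortedB []           = true
sortedB (x ∷ [])     = true
sortedB (x ∷ y ∷ xs) = leqB x y ∧ sortedB (y ∷ xs)

sortingB : ℕ → Network → Bool
sortingB n C = onChannelsB n C ∧ all sortedB (outputs n C)

_==N_ : Network → Network → Bool
C ==N C' = does (≡-dec (×-≡-dec _≟ℕ_ _≟ℕ_) C C')

_==L_ : List Bool → List Bool → Bool
x ==L y = does (≡-dec _≟B_ x y)

elemN : Network → List Network → Bool
elemN C R = any (C ==N_) R

removeN : Network → List Network → List Network
removeN C' R = filter (λ D → ¬? (≡-dec (×-≡-dec _≟ℕ_ _≟ℕ_) D C')) R

redundantB : ℕ → Network → Comparator → Bool
redundantB n C (i , j) =
  all (λ y → leqB (lookupD y i) (lookupD y j)) (outputs n C)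

stdPairs : ℕ → List Comparator
stdPairs n = concatMap (λ j → map (λ i → (i , j)) (upTo j)) (upTo n)

OGenerate : List Network → ℕ → List Network
OGenerate R n =
  concatMap (λ C → map (λ c → C ++ [ c ])
                       (filter (λ c → T? (not (redundantB n C c)))
                               (stdPairs n)))
            R

distinctB : List ℕ → Bool
distinctB []       = true
distinctB (k ∷ ks) = not (any (k ≡ᵇ_) ks) ∧ distinctB ks

isPermB : ℕ → List ℕ → Bool
isPermB n π = (length π ≡ᵇ n) ∧ all (_<ᵇ n) π ∧ distinctB π

-- π(x) = y with y_{π_i} = x_i  (meaningful when π represents a permutation)
permuteAux : List ℕ → List Bool → List Bool → List Bool
permuteAux []       _        y = y
permuteAux (p ∷ π)  []       y = y
permuteAux (p ∷ π)  (b ∷ x)  y = permuteAux π x (update y p b)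

permute : List ℕ → List Bool → List Bool
permute π x = permuteAux π x x

leqπB : ℕ → List ℕ → Network → Network → Bool
leqπB n π C C' =
  all (λ y → any (λ z → permute π y ==L z) (outputs n C')) (outputs n C)

Prune : List (Network × Network × List ℕ) → List Network → ℕ → List Network
Prune []                  R n = R
Prune ((C , C' , π) ∷ X)  R n =
  if (C ==N C') ∨ not (elemN C R) ∨ not (isPermB n π) ∨ not (leqπB n π C C')
  then R
  else Prune X (removeN C' R) n

data Result : Set where
  yes   : ℕ → ℕ → Result
  no    : ℕ → ℕ → List Network → Result
  maybe : Result

step : Oracle → Result → Result
step X maybe       = maybe
step X (yes p q)   = yes p q
step X (no p q R)  =
  let R' = Prune X (OGenerate R p) p in
  if any (sortingB p) R' then yes p (suc q) else no p (suc q) R'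

GP : ℕ → ℕ → List Oracle → Result
GP zero          zero    O        = yes 0 0
GP (suc zero)    zero    O        = yes 1 0
GP (suc (suc m)) zero    O        = no (suc (suc m)) 0 ([] ∷ [])
GP m             (suc n) []       = maybe
GP m             (suc n) (X ∷ O') = step X (GP m n O')

-- A round of generate-and-prune preserves the following invariant: every network in R is standard
-- and not sorting, and every sorting network C on m channels splits, up to a relabelling of its output
-- channels, as a prefix E ∈ R followed by a suffix D with n + |D| ≤ |C|.  If the first comparator of
-- D is redundant after E it can be dropped; otherwise, after transposing channels in the rest of D to
-- make it standard, it extends E to a network produced by OGenerate.  Pruning with C ≤_π C′ is
-- harmless because relabelling D by π⁻¹ turns a completion of C′ into one of C.  Finally D ≠ []: a
-- standard prefix fixes the sorted 0-1 inputs 0…01…1, so a relabelling under which it sorts is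
-- increasing, hence the identity, and E itself would sort.

module Submission where

open import Defs
open import Data.Bool using (Bool; true; false; b≤b; f≤t; _∧_; _∨_; not; T) renaming (_≤_ to _≤B_)
open import Data.Bool.ListAction using (all; any)
open import Data.Bool.Properties using (∧-comm; ∨-comm; T-≡; T-not-≡; T-∧)
  renaming (_≟_ to _≟B_; ≤-trans to ≤B-trans; ≤-minimum to ≤B-minimum)
open import Data.Empty using (⊥-elim)
open import Data.List using (List; []; _∷_; _++_; [_]; map; length; applyUpTo; replicate)
open import Data.List.Membership.Propositional using (_∈_; lose; find)
open import Data.List.Membership.Propositional.Properties
open import Data.List.Properties using (length-applyUpTo; length-map; length-replicate; ≡-dec)
open import Data.List.Relation.Unary.All as All using (All; []; _∷_)
open import Data.List.Relation.Unary.All.Properties using (all⁺; all⁻; map⁺; filter⁺; concat⁺; ++⁺; all-upTo)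
open import Data.List.Relation.Unary.Any as Any using (here; there)
open import Data.List.Relation.Unary.Any.Properties using (any⁺; any⁻)
open import Data.List.Relation.Unary.Linked using (Linked; [-]; _∷_)
open import Data.Nat using (ℕ; zero; suc; z<s; z≤n; s≤s; s≤s⁻¹; _<_; _≤_; _<ᵇ_; _≤ᵇ_; _≡ᵇ_; _+_; _<?_)
open import Data.Nat.Induction using (<-wellFounded)
open import Data.Nat.Properties
open import Data.Product using (_×_; _,_; proj₁; proj₂; ∃; ∃₂)
open import Data.Product.Properties using () renaming (≡-dec to ×-≡-dec)
open import Data.Sum using (inj₁; inj₂)
open import Function using (_∘_; id; Equivalence)
open import Induction.WellFounded using (Acc; acc)
open import Relation.Binary.Definitions using (DecidableEquality; tri<; tri≈; tri>)
open import Relation.Binary.PropositionalEquality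
  using (_≡_; refl; sym; trans; cong; subst; subst₂; _≢_; module ≡-Reasoning)
open import Relation.Nullary using (Dec; does; ¬_; ¬?; contradiction) renaming (yes to yes′; no to no′)

private
  T⇒≡ : ∀ {b} → T b → b ≡ true
  T⇒≡ = Equivalence.to T-≡

  ≡⇒T : ∀ {b} → b ≡ true → T b
  ≡⇒T = Equivalence.from T-≡

  does-sound : ∀ {P : Set} (P? : Dec P) → T (does P?) → P
  does-sound (yes′ p) _ = p

  not-does-sound : ∀ {P : Set} (P? : Dec P) → T (not (does P?)) → ¬ P
  not-does-sound (no′ ¬p) _ = ¬p

  T-not : ∀ {b} → ¬ T b → T (not b)
  T-not {false} _  = _
  T-not {true}  ¬t = ¬t _

  unordered : ∀ {u v} → leqB u v ≡ false → u ≡ true × v ≡ false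
  unordered {true} {false} _ = refl , refl

  ≤B⇒leqB : ∀ {u v} → u ≤B v → leqB u v ≡ true
  ≤B⇒leqB f≤t = refl
  ≤B⇒leqB {false} b≤b = refl
  ≤B⇒leqB {true}  b≤b = refl

-- Transpositions and injections of [0, n)

transpose : ℕ → ℕ → ℕ → ℕ
transpose a b k with k ≟ a
... | yes′ _ = b
... | no′ _ with k ≟ b
...   | yes′ _ = a
...   | no′ _  = k

transpose-a : ∀ a b → transpose a b a ≡ b
transpose-a a b with a ≟ a
... | yes′ _  = refl
... | no′ a≢a = ⊥-elim (a≢a refl)

transpose-b : ∀ a b → transpose a b b ≡ a
transpose-b a b with b ≟ a
... | yes′ b≡a = b≡a
... | no′ _ with b ≟ b
...   | yes′ _  = refl
...   | no′ b≢b = ⊥-elim (b≢b refl)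

transpose-other : ∀ {a b k} → k ≢ a → k ≢ b → transpose a b k ≡ k
transpose-other {a} {b} {k} k≢a k≢b with k ≟ a
... | yes′ k≡a = ⊥-elim (k≢a k≡a)
... | no′ _ with k ≟ b
...   | yes′ k≡b = ⊥-elim (k≢b k≡b)
...   | no′ _    = refl

transpose-involutive : ∀ a b k → transpose a b (transpose a b k) ≡ k
transpose-involutive a b k = cases (k ≟ a) (k ≟ b)
  where
  cases : Dec (k ≡ a) → Dec (k ≡ b) → transpose a b (transpose a b k) ≡ k
  cases (yes′ refl) _ = trans (cong (transpose a b) (transpose-a a b)) (transpose-b a b)
  cases (no′ _) (yes′ refl) = trans (cong (transpose a b) (transpose-b a b)) (transpose-a a b)
  cases (no′ k≢a) (no′ k≢b) =
    trans (cong (transpose a b) (transpose-other k≢a k≢b)) (transpose-other k≢a k≢b)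

transpose-injective : ∀ a b {i j} → transpose a b i ≡ transpose a b j → i ≡ j
transpose-injective a b {i} {j} eq =
  trans (sym (transpose-involutive a b i)) (trans (cong (transpose a b) eq) (transpose-involutive a b j))

transpose-< : ∀ {a b k n} → a < n → b < n → k < n → transpose a b k < n
transpose-< {a} {b} {k} a< b< k< with k ≟ a
... | yes′ _ = b<
... | no′ _ with k ≟ b
...   | yes′ _ = a<
...   | no′ _  = k<

record InjectiveBelow (n : ℕ) (p : ℕ → ℕ) : Set where
  field
    mapsTo    : ∀ {k} → k < n → p k < n
    injective : ∀ {i j} → i < n → j < n → p i ≡ p j → i ≡ j

open InjectiveBelow

id-injectiveBelow : ∀ {n} → InjectiveBelow n id
id-injectiveBelow = record { mapsTo = id ; injective = λ _ _ → id }

∘-injectiveBelow : ∀ {n p q} → InjectiveBelow n p → InjectiveBelow n q → InjectiveBelow n (p ∘ q)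
∘-injectiveBelow P Q = record
  { mapsTo    = mapsTo P ∘ mapsTo Q
  ; injective = λ i< j< → injective Q i< j< ∘ injective P (mapsTo Q i<) (mapsTo Q j<)
  }

transpose-injectiveBelow : ∀ {n a b} → a < n → b < n → InjectiveBelow n (transpose a b)
transpose-injectiveBelow {a = a} {b} a< b< = record
  { mapsTo    = transpose-< a< b<
  ; injective = λ _ _ → transpose-injective a b
  }

-- The transposition sends p n to n, so it sends the image of [0, n) into [0, n).
restrict-injectiveBelow : ∀ {n p} → InjectiveBelow (suc n) p →
                          InjectiveBelow n (transpose (p n) n ∘ p)
restrict-injectiveBelow {n} {p} P = record
  { mapsTo    = λ {k} k< → ≤∧≢⇒< (s≤s⁻¹ (mapsTo τ (mapsTo P (m<n⇒m<1+n k<))))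
                  λ eq → <⇒≢ k< (injective P (m<n⇒m<1+n k<) (n<1+n n)
                    (transpose-injective (p n) n (trans eq (sym (transpose-a (p n) n)))))
  ; injective = λ i< j< → injective P (m<n⇒m<1+n i<) (m<n⇒m<1+n j<) ∘ transpose-injective (p n) n
  }
  where τ = transpose-injectiveBelow (mapsTo P (n<1+n n)) (n<1+n n)

injectiveBelow⇒surjective : ∀ {n p} → InjectiveBelow n p → ∀ {i} → i < n → ∃ λ k → k < n × p k ≡ i
injectiveBelow⇒surjective {suc n} {p} P {i} i< with transpose (p n) n i ≟ n
... | yes′ eq = n , n<1+n n ,
  transpose-injective (p n) n (trans (transpose-a (p n) n) (sym eq))
... | no′ ≢n with injectiveBelow⇒surjective (restrict-injectiveBelow P)
                   (≤∧≢⇒< (s≤s⁻¹ (transpose-< (mapsTo P (n<1+n n)) (n<1+n n) i<)) ≢n)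
... | k , k< , eq = k , m<n⇒m<1+n k< , transpose-injective (p n) n eq

module _ {n p} (P : InjectiveBelow n p) where

  -- The value at i ≥ n is junk.
  inverse : ℕ → ℕ
  inverse i with i <? n
  ... | yes′ i< = proj₁ (injectiveBelow⇒surjective P i<)
  ... | no′ _   = 0

  inverse-spec : ∀ {i} → i < n → inverse i < n × p (inverse i) ≡ i
  inverse-spec {i} i< with i <? n
  ... | yes′ i<′ = proj₂ (injectiveBelow⇒surjective P i<′)
  ... | no′ i≮  = ⊥-elim (i≮ i<)

  inverse-injectiveBelow : InjectiveBelow n inverse
  inverse-injectiveBelow = record
    { mapsTo    = proj₁ ∘ inverse-spec
    ; injective = λ i< j< eq →
        trans (sym (proj₂ (inverse-spec i<))) (trans (cong p eq) (proj₂ (inverse-spec j<)))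
    }

module _ {n} {f : ℕ → ℕ} (bounded : ∀ {k} → k < n → f k < n)
         (increasing : ∀ {i j} → i < j → j < n → f i < f j) where

  private
    increasing-suc : ∀ {k} → suc k < n → f k < f (suc k)
    increasing-suc = increasing (n<1+n _)

    ≤-increasing : ∀ {k} → k < n → k ≤ f k
    ≤-increasing {zero}  _  = z≤n
    ≤-increasing {suc k} k< = ≤-<-trans (≤-increasing (<-trans (n<1+n k) k<)) (increasing-suc k<)

    +-mapsTo : ∀ d {k} → k + d < n → f k + d < n
    +-mapsTo zero    {k} k< rewrite +-identityʳ k | +-identityʳ (f k) = bounded k<
    +-mapsTo (suc d) {k} k< rewrite +-suc k d | +-suc (f k) d =
      ≤-<-trans (+-monoˡ-≤ d (increasing-suc (≤-<-trans (m≤m+n (suc k) d) k<))) (+-mapsTo d k<)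

    ≥-increasing : ∀ {k} → k < n → f k ≤ k
    ≥-increasing {k} k< with d , refl ← m≤n⇒∃[o]m+o≡n k< =
      s≤s⁻¹ (+-cancelʳ-< d (f k) (suc k) (+-mapsTo d (n<1+n (k + d))))

  increasing⇒id : ∀ {k} → k < n → f k ≡ k
  increasing⇒id k< = ≤-antisym (≥-increasing k<) (≤-increasing k<)

length-update : ∀ x i b → length (update x i b) ≡ length x
length-update []       i       b = refl
length-update (x ∷ xs) zero    b = refl
length-update (x ∷ xs) (suc i) b = cong suc (length-update xs i b)

lookup-update-≡ : ∀ x {i} b → i < length x → lookupD (update x i b) i ≡ b
lookup-update-≡ (x ∷ xs) {zero}  b _         = refl
lookup-update-≡ (x ∷ xs) {suc i} b (s≤s i<) = lookup-update-≡ xs b i<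

lookup-update-≢ : ∀ x {i k} b → k ≢ i → lookupD (update x i b) k ≡ lookupD x k
lookup-update-≢ []       b k≢i = refl
lookup-update-≢ (x ∷ xs) {zero}  {zero}  b k≢i = ⊥-elim (k≢i refl)
lookup-update-≢ (x ∷ xs) {zero}  {suc k} b k≢i = refl
lookup-update-≢ (x ∷ xs) {suc i} {zero}  b k≢i = refl
lookup-update-≢ (x ∷ xs) {suc i} {suc k} b k≢i = lookup-update-≢ xs b (k≢i ∘ cong suc)

length-applyComp : ∀ c x → length (applyComp c x) ≡ length x
length-applyComp (i , j) x with (i <ᵇ length x) ∧ (j <ᵇ length x) | leqB (lookupD x i) (lookupD x j)
... | false | _     = refl
... | true  | true  = refl
... | true  | false = trans (length-update (update x i (lookupD x j)) j _) (length-update x i _)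

length-run : ∀ C x → length (run C x) ≡ length x
length-run []      x = refl
length-run (c ∷ C) x = trans (length-run C (applyComp c x)) (length-applyComp c x)

run-++ : ∀ C D x → run (C ++ D) x ≡ run D (run C x)
run-++ []      D x = refl
run-++ (c ∷ C) D x = run-++ C D (applyComp c x)

applyComp-ordered : ∀ {i j} x → leqB (lookupD x i) (lookupD x j) ≡ true → applyComp (i , j) x ≡ x
applyComp-ordered {i} {j} x x≤ with (i <ᵇ length x) ∧ (j <ᵇ length x)
... | false = refl
... | true rewrite x≤ = refl

lookup-applyUpTo : ∀ (f : ℕ → Bool) n {k} → k < n → lookupD (applyUpTo f n) k ≡ f k
lookup-applyUpTo f (suc n) {zero}  _        = refl
lookup-applyUpTo f (suc n) {suc k} (s≤s k<) = lookup-applyUpTo (f ∘ suc) n k<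

∈-inputs : ∀ x → x ∈ inputs (length x)
∈-inputs []          = here refl
∈-inputs (false ∷ x) = ∈-++⁺ˡ (∈-map⁺ (false ∷_) (∈-inputs x))
∈-inputs (true ∷ x)  = ∈-++⁺ʳ (map (false ∷_) (inputs (length x))) (∈-map⁺ (true ∷_) (∈-inputs x))

length-∈-inputs : ∀ n {x} → x ∈ inputs n → length x ≡ n
length-∈-inputs zero    (here refl) = refl
length-∈-inputs (suc n) x∈ with ∈-++⁻ (map (false ∷_) (inputs n)) x∈
... | inj₁ x∈₀ with _ , y∈ , refl ← ∈-map⁻ (false ∷_) x∈₀ = cong suc (length-∈-inputs n y∈)
... | inj₂ x∈₁ with _ , y∈ , refl ← ∈-map⁻ (true ∷_) x∈₁  = cong suc (length-∈-inputs n y∈)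

run-∈-outputs : ∀ {n} C x → length x ≡ n → run C x ∈ outputs n C
run-∈-outputs C x refl = ∈-map⁺ (run C) (∈-inputs x)

∈-outputs : ∀ n C {y} → y ∈ outputs n C → ∃ λ x → length x ≡ n × y ≡ run C x
∈-outputs n C y∈ with x , x∈ , refl ← ∈-map⁻ (run C) y∈ = x , length-∈-inputs n x∈ , refl

-- Inputs as functions of the channel index

-- On functions a comparator needs no bounds check, which makes relabelling channels painless.
applyCompᶠ : Comparator → (ℕ → Bool) → ℕ → Bool
applyCompᶠ (a , b) g k with k ≟ a
... | yes′ _ = g a ∧ g b
... | no′ _ with k ≟ b
...   | yes′ _ = g a ∨ g b
...   | no′ _  = g k

runᶠ : Network → (ℕ → Bool) → ℕ → Bool
runᶠ []      g = g
runᶠ (c ∷ C) g = runᶠ C (applyCompᶠ c g)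

applyCompᶠ-ordered : ∀ {a b} g → leqB (g a) (g b) ≡ true → ∀ k → applyCompᶠ (a , b) g k ≡ g k
applyCompᶠ-ordered {a} {b} g ga≤gb k with k ≟ a
... | yes′ refl = ∧-leq (g k) (g b) ga≤gb
  where ∧-leq : ∀ u v → leqB u v ≡ true → u ∧ v ≡ u
        ∧-leq false v _ = refl
        ∧-leq true true _ = refl
... | no′ _ with k ≟ b
...   | yes′ refl = ∨-leq (g a) (g k) ga≤gb
  where ∨-leq : ∀ u v → leqB u v ≡ true → u ∨ v ≡ v
        ∨-leq false v _ = refl
        ∨-leq true true _ = refl
...   | no′ _ = refl

applyCompᶠ-min : ∀ a b g → applyCompᶠ (a , b) g a ≡ g a ∧ g b
applyCompᶠ-min a b g with a ≟ a
... | yes′ _  = refl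
... | no′ a≢a = ⊥-elim (a≢a refl)

applyCompᶠ-max : ∀ {a b} g → a ≢ b → applyCompᶠ (a , b) g b ≡ g a ∨ g b
applyCompᶠ-max {a} {b} g a≢b with b ≟ a
... | yes′ b≡a = ⊥-elim (a≢b (sym b≡a))
... | no′ _ with b ≟ b
...   | yes′ _  = refl
...   | no′ b≢b = ⊥-elim (b≢b refl)

applyCompᶠ-other : ∀ {a b k} g → k ≢ a → k ≢ b → applyCompᶠ (a , b) g k ≡ g k
applyCompᶠ-other {a} {b} {k} g k≢a k≢b with k ≟ a
... | yes′ k≡a = ⊥-elim (k≢a k≡a)
... | no′ _ with k ≟ b
...   | yes′ k≡b = ⊥-elim (k≢b k≡b)
...   | no′ _    = refl

lookup-applyComp : ∀ {a b} x → a < length x → b < length x → a ≢ b →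
                   ∀ k → lookupD (applyComp (a , b) x) k ≡ applyCompᶠ (a , b) (lookupD x) k
lookup-applyComp {a} {b} x a< b< a≢b k
  rewrite T⇒≡ (<⇒<ᵇ a<) | T⇒≡ (<⇒<ᵇ b<)
  with leqB (lookupD x a) (lookupD x b) in le
... | true  = sym (applyCompᶠ-ordered (lookupD x) le k)
... | false with unordered le | k ≟ a
...   | xa , xb | yes′ refl rewrite xa | xb =
  trans (lookup-update-≢ (update x k false) true a≢b) (lookup-update-≡ x false a<)
...   | xa , xb | no′ k≢a with k ≟ b
...     | yes′ refl rewrite xa | xb =
  lookup-update-≡ (update x a false) true (subst (k <_) (sym (length-update x a false)) b<)
...     | no′ k≢b = trans (lookup-update-≢ (update x a _) _ k≢b) (lookup-update-≢ x _ k≢a)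

applyCompᶠ-transpose : ∀ {a b} g → a ≢ b → ∀ k →
                       applyCompᶠ (a , b) g k ≡ applyCompᶠ (b , a) g (transpose a b k)
applyCompᶠ-transpose {a} {b} g a≢b k = cases (k ≟ a) (k ≟ b)
  where
  open ≡-Reasoning
  cases : Dec (k ≡ a) → Dec (k ≡ b) →
          applyCompᶠ (a , b) g k ≡ applyCompᶠ (b , a) g (transpose a b k)
  cases (yes′ refl) _ = begin
    applyCompᶠ (a , b) g a             ≡⟨ applyCompᶠ-min a b g ⟩
    g a ∧ g b                          ≡⟨ ∧-comm (g a) (g b) ⟩
    g b ∧ g a                          ≡⟨ applyCompᶠ-min b a g ⟨
    applyCompᶠ (b , a) g b             ≡⟨ cong (applyCompᶠ (b , a) g) (transpose-a a b) ⟨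
    applyCompᶠ (b , a) g (transpose a b a) ∎
  cases (no′ _) (yes′ refl) = begin
    applyCompᶠ (a , b) g b             ≡⟨ applyCompᶠ-max g a≢b ⟩
    g a ∨ g b                          ≡⟨ ∨-comm (g a) (g b) ⟩
    g b ∨ g a                          ≡⟨ applyCompᶠ-max g (a≢b ∘ sym) ⟨
    applyCompᶠ (b , a) g a             ≡⟨ cong (applyCompᶠ (b , a) g) (transpose-b a b) ⟨
    applyCompᶠ (b , a) g (transpose a b b) ∎
  cases (no′ k≢a) (no′ k≢b) = begin
    applyCompᶠ (a , b) g k             ≡⟨ applyCompᶠ-other g k≢a k≢b ⟩
    g k                                ≡⟨ applyCompᶠ-other g k≢b k≢a ⟨
    applyCompᶠ (b , a) g k             ≡⟨ cong (applyCompᶠ (b , a) g) (transpose-other k≢a k≢b) ⟨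
    applyCompᶠ (b , a) g (transpose a b k) ∎

relabel : (ℕ → ℕ) → Network → Network
relabel p = map (λ { (a , b) → (p a , p b) })

size-relabel : ∀ p D → size (relabel p D) ≡ size D
size-relabel p D = length-map _ D

lookupℕ : List ℕ → ℕ → ℕ
lookupℕ []       _       = 0
lookupℕ (k ∷ ks) zero    = k
lookupℕ (k ∷ ks) (suc i) = lookupℕ ks i

lookupℕ-∈ : ∀ ks {i} → i < length ks → lookupℕ ks i ∈ ks
lookupℕ-∈ (k ∷ ks) {zero}  _        = here refl
lookupℕ-∈ (k ∷ ks) {suc i} (s≤s i<) = there (lookupℕ-∈ ks i<)

Distinct : List ℕ → Set
Distinct π = ∀ {i j} → i < length π → j < length π → lookupℕ π i ≡ lookupℕ π j → i ≡ j

head-fresh : ∀ {k π j} → T (distinctB (k ∷ π)) → j < length π → k ≢ lookupℕ π j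
head-fresh {k} {π} distinct j< eq =
  subst T (Equivalence.to T-not-≡ (proj₁ (Equivalence.to T-∧ distinct)))
        (any⁺ _ (lose (lookupℕ-∈ π j<) (≡⇒≡ᵇ k _ eq)))

distinctB-sound : ∀ π → T (distinctB π) → Distinct π
distinctB-sound (k ∷ π) distinct {zero}  {zero}  _        _        _  = refl
distinctB-sound (k ∷ π) distinct {zero}  {suc j} _        (s≤s j<) eq = ⊥-elim (head-fresh {π = π} distinct j< eq)
distinctB-sound (k ∷ π) distinct {suc i} {zero}  (s≤s i<) _        eq = ⊥-elim (head-fresh {π = π} distinct i< (sym eq))
distinctB-sound (k ∷ π) distinct {suc i} {suc j} (s≤s i<) (s≤s j<) eq =
  cong suc (distinctB-sound π (proj₂ (Equivalence.to T-∧ distinct)) i< j< eq)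

permuteAux-untouched : ∀ π x z {i} → (∀ {k} → k < length π → lookupℕ π k ≢ i) →
                       lookupD (permuteAux π x z) i ≡ lookupD z i
permuteAux-untouched []      x       z untouched = refl
permuteAux-untouched (p ∷ π) []      z untouched = refl
permuteAux-untouched (p ∷ π) (b ∷ x) z untouched =
  trans (permuteAux-untouched π x (update z p b) (untouched ∘ s≤s))
        (lookup-update-≢ z b (untouched z<s ∘ sym))

permuteAux-placed : ∀ π x z → Distinct π → (∀ {k} → k < length π → lookupℕ π k < length z) →
                    length π ≤ length x →
                    ∀ {k} → k < length π → lookupD (permuteAux π x z) (lookupℕ π k) ≡ lookupD x k
permuteAux-placed (p ∷ π) (b ∷ x) z distinct bounded _ {zero} _ =
  trans (permuteAux-untouched π x (update z p b) (λ k< eq → case (distinct (s≤s k<) z<s eq)))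
        (lookup-update-≡ z b (bounded z<s))
  where case : ∀ {k} → suc k ≢ 0
        case ()
permuteAux-placed (p ∷ π) (b ∷ x) z distinct bounded (s≤s ∣π∣≤) {suc k} (s≤s k<) =
  permuteAux-placed π x (update z p b) (λ i< j< → suc-injective ∘ distinct (s≤s i<) (s≤s j<))
    (λ k< → subst (_ <_) (sym (length-update z p b)) (bounded (s≤s k<))) ∣π∣≤ k<

lookup-permute : ∀ π y → length π ≡ length y → Distinct π → (∀ {k} → k < length π → lookupℕ π k < length y) →
                 ∀ {k} → k < length π → lookupD (permute π y) (lookupℕ π k) ≡ lookupD y k
lookup-permute π y ∣π∣≡∣y∣ distinct bounded =
  permuteAux-placed π y y distinct bounded (≤-reflexive ∣π∣≡∣y∣)

infix 4 _≟N_
_≟N_ : DecidableEquality Network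
_≟N_ = ≡-dec (×-≡-dec _≟_ _≟_)

∨-not-≡false : ∀ a b c d → a ∨ not b ∨ not c ∨ not d ≡ false → T (not a) × T b × T c × T d
∨-not-≡false false true  true  true  _  = _ , _ , _ , _
∨-not-≡false true  _     _     _     ()
∨-not-≡false false false _     _     ()
∨-not-≡false false true  false _     ()
∨-not-≡false false true  true  false ()

module Networks (m : ℕ) where

  infix 4 _≈_
  _≈_ : (ℕ → Bool) → (ℕ → Bool) → Set
  g ≈ h = ∀ {k} → k < m → g k ≡ h k

  applyCompᶠ-cong : ∀ {a b g h} → a < m → b < m → g ≈ h → applyCompᶠ (a , b) g ≈ applyCompᶠ (a , b) h
  applyCompᶠ-cong {a} {b} a< b< g≈h {k} k< with k ≟ a
  ... | yes′ _ rewrite g≈h a< | g≈h b< = refl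
  ... | no′ _ with k ≟ b
  ...   | yes′ _ rewrite g≈h a< | g≈h b< = refl
  ...   | no′ _  = g≈h k<

  runᶠ-cong : ∀ {D g h} → OnChannels m D → g ≈ h → runᶠ D g ≈ runᶠ D h
  runᶠ-cong []                      g≈h = g≈h
  runᶠ-cong ((a< , b< , _) ∷ onD) g≈h = runᶠ-cong onD (applyCompᶠ-cong a< b< g≈h)

  lookup-run : ∀ {D} x → OnChannels m D → length x ≡ m → lookupD (run D x) ≈ runᶠ D (lookupD x)
  lookup-run {[]}          x []                         ∣x∣ k< = refl
  lookup-run {(a , b) ∷ D} x ((a< , b< , a≢b) ∷ onD) ∣x∣ k< =
    trans (lookup-run (applyComp (a , b) x) onD (trans (length-applyComp (a , b) x) ∣x∣) k<)
          (runᶠ-cong onD (λ {j} _ → lookup-applyComp x (<-len a<) (<-len b<) a≢b j) k<)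
    where <-len : ∀ {i} → i < m → i < length x
          <-len = subst (_ <_) (sym ∣x∣)

  onChannels-relabel : ∀ {p D} → InjectiveBelow m p → OnChannels m D → OnChannels m (relabel p D)
  onChannels-relabel P []                         = []
  onChannels-relabel P ((a< , b< , a≢b) ∷ onD) =
    (mapsTo P a< , mapsTo P b< , a≢b ∘ injective P a< b<) ∷ onChannels-relabel P onD

  applyCompᶠ-relabel : ∀ {p a b} h → InjectiveBelow m p → a < m → b < m →
                       applyCompᶠ (p a , p b) h ∘ p ≈ applyCompᶠ (a , b) (h ∘ p)
  applyCompᶠ-relabel {p} {a} {b} h P a< b< {k} k< with p k ≟ p a | k ≟ a
  ... | yes′ _   | yes′ _    = refl
  ... | yes′ eq  | no′ k≢a   = ⊥-elim (k≢a (injective P k< a< eq))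
  ... | no′ pk≢pa | yes′ refl = ⊥-elim (pk≢pa refl)
  ... | no′ _    | no′ _ with p k ≟ p b | k ≟ b
  ...   | yes′ _   | yes′ _    = refl
  ...   | yes′ eq  | no′ k≢b   = ⊥-elim (k≢b (injective P k< b< eq))
  ...   | no′ pk≢pb | yes′ refl = ⊥-elim (pk≢pb refl)
  ...   | no′ _    | no′ _     = refl

  runᶠ-relabel : ∀ {p D} h → InjectiveBelow m p → OnChannels m D →
                 runᶠ (relabel p D) h ∘ p ≈ runᶠ D (h ∘ p)
  runᶠ-relabel h P []                    k< = refl
  runᶠ-relabel h P ((a< , b< , _) ∷ onD) k< =
    trans (runᶠ-relabel _ P onD k<) (runᶠ-cong onD (applyCompᶠ-relabel h P a< b<) k<)

  Sorted : (ℕ → Bool) → Set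
  Sorted g = ∀ {i j} → i < j → j < m → g i ≤B g j

  sorted-resp-≈ : ∀ {g h} → g ≈ h → Sorted g → Sorted h
  sorted-resp-≈ g≈h sorted i<j j< =
    subst₂ _≤B_ (g≈h (<-trans i<j j<)) (g≈h j<) (sorted i<j j<)

  Sorts : Network → Set
  Sorts E = ∀ x → length x ≡ m → Sorted (lookupD (run E x))

  -- D completes the prefix E to a sorting network up to a relabelling ρ of the output channels.
  record Completion (E D : Network) : Set where
    field
      onChannels  : OnChannels m D
      ρ           : ℕ → ℕ
      ρ-injective : InjectiveBelow m ρ
      sorts       : ∀ x → length x ≡ m → Sorted (runᶠ D (lookupD (run E x)) ∘ ρ)

  open Completion

  linked⇒sorted : ∀ {y} → Linked _≤B_ y → ∀ {i j} → i < j → j < length y → lookupD y i ≤B lookupD y j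
  linked⇒sorted [-] {j = suc _} _ (s≤s ())
  linked⇒sorted (y₀≤y₁ ∷ _)     {zero}  {suc zero}    _         _        = y₀≤y₁
  linked⇒sorted (y₀≤y₁ ∷ sorted) {zero}  {suc (suc j)} _         (s≤s j<) =
    ≤B-trans y₀≤y₁ (linked⇒sorted sorted {zero} {suc j} z<s j<)
  linked⇒sorted (_ ∷ sorted)     {suc i} {suc j}       (s≤s i<j) (s≤s j<) = linked⇒sorted sorted i<j j<

  sortingNetwork-completion : ∀ {C} → SortingNetwork m C → Completion [] C
  sortingNetwork-completion {C} (onC , sortsC) = record
    { onChannels  = onC
    ; ρ           = id
    ; ρ-injective = id-injectiveBelow
    ; sorts       = λ x ∣x∣ → sorted-resp-≈ (lookup-run x onC ∣x∣)
        (λ i<j j< → linked⇒sorted (sortsC x ∣x∣) i<j (subst (_ <_) (sym (trans (length-run C x) ∣x∣)) j<))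
    }

  redundant-ordered : ∀ {E a b} x → T (redundantB m E (a , b)) → length x ≡ m →
                      leqB (lookupD (run E x) a) (lookupD (run E x) b) ≡ true
  redundant-ordered {E} x redundant ∣x∣ =
    T⇒≡ (All.lookup (all⁺ _ (outputs m E) redundant) (run-∈-outputs E x ∣x∣))

  completion-dropRedundant : ∀ {E a b D} → T (redundantB m E (a , b)) →
                             Completion E ((a , b) ∷ D) → Completion E D
  completion-dropRedundant {E} redundant c@record { onChannels = _ ∷ onD } = record
    { onChannels  = onD
    ; ρ           = ρ c
    ; ρ-injective = ρ-injective c
    ; sorts       = λ x ∣x∣ → sorted-resp-≈
        (λ k< → runᶠ-cong onD (λ {j} _ → applyCompᶠ-ordered _ (redundant-ordered {E} x redundant ∣x∣) j)
                          (mapsTo (ρ-injective c) k<))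
        (sorts c x ∣x∣)
    }

  completion-shift : ∀ {E a b D} → Completion E ((a , b) ∷ D) → Completion (E ++ [ (a , b) ]) D
  completion-shift {E} {a} {b} c@record { onChannels = (a< , b< , a≢b) ∷ onD } = record
    { onChannels  = onD
    ; ρ           = ρ c
    ; ρ-injective = ρ-injective c
    ; sorts       = λ x ∣x∣ → sorted-resp-≈
        (λ k< → runᶠ-cong onD (λ {j} _ → sym (lookup-run-snoc x ∣x∣ j)) (mapsTo (ρ-injective c) k<))
        (sorts c x ∣x∣)
    }
    where
    lookup-run-snoc : ∀ x → length x ≡ m → ∀ j →
                      lookupD (run (E ++ [ (a , b) ]) x) j ≡ applyCompᶠ (a , b) (lookupD (run E x)) j
    lookup-run-snoc x ∣x∣ j rewrite run-++ E [ (a , b) ] x =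
      lookup-applyComp (run E x) (<-len a<) (<-len b<) a≢b j
      where <-len : ∀ {i} → i < m → i < length (run E x)
            <-len = subst (_ <_) (sym (trans (length-run E x) ∣x∣))

  completion-flip : ∀ {E a b D} → Completion E ((a , b) ∷ D) →
                    Completion E ((b , a) ∷ relabel (transpose a b) D)
  completion-flip {E} {a} {b} c@record { onChannels = (a< , b< , a≢b) ∷ onD } = record
    { onChannels  = (b< , a< , a≢b ∘ sym) ∷ onChannels-relabel τ onD
    ; ρ           = transpose a b ∘ ρ c
    ; ρ-injective = ∘-injectiveBelow τ (ρ-injective c)
    ; sorts       = λ x ∣x∣ → sorted-resp-≈
        (λ k< → let ρk< = mapsTo (ρ-injective c) k< in sym (trans
          (runᶠ-relabel _ τ onD ρk<)
          (runᶠ-cong onD (λ {j} _ → sym (applyCompᶠ-transpose _ a≢b j)) ρk<)))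
        (sorts c x ∣x∣)
    }
    where τ = transpose-injectiveBelow a< b<

  -- Standard networks

  StandardComparator : Comparator → Set
  StandardComparator (i , j) = i < j × j < m

  Standard : Network → Set
  Standard = All StandardComparator

  run-standard-sorted : ∀ {E y} → Standard E → Sorted (lookupD y) → run E y ≡ y
  run-standard-sorted                     []                  sorted = refl
  run-standard-sorted {(i , j) ∷ E} {y} ((i<j , j<) ∷ stdE) sorted
    rewrite applyComp-ordered y (≤B⇒leqB (sorted i<j j<)) = run-standard-sorted stdE sorted

  threshold : ℕ → List Bool
  threshold w = applyUpTo (w ≤ᵇ_) m

  lookup-threshold : ∀ w {k} → k < m → lookupD (threshold w) k ≡ (w ≤ᵇ k)
  lookup-threshold w = lookup-applyUpTo (w ≤ᵇ_) m

  sorted-threshold : ∀ w → Sorted (lookupD (threshold w))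
  sorted-threshold w {i} {j} i<j j<
    rewrite lookup-threshold w (<-trans i<j j<) | lookup-threshold w j< with w ≤ᵇ i in w≤i
  ... | false = ≤B-minimum (w ≤ᵇ j)
  ... | true rewrite T⇒≡ (≤⇒≤ᵇ (≤-trans (≤ᵇ⇒≤ w i (≡⇒T w≤i)) (<⇒≤ i<j))) = b≤b

  -- A standard prefix fixes threshold inputs, so sorting them after relabelling forces ρ to be increasing.
  relabelling-increasing : ∀ {E ρ} → Standard E → InjectiveBelow m ρ →
                           (∀ x → length x ≡ m → Sorted (lookupD (run E x) ∘ ρ)) →
                           ∀ {i j} → i < j → j < m → ρ i < ρ j
  relabelling-increasing {E} {ρ} stdE P sorts {i} {j} i<j j< with ρ i ≤ᵇ ρ j in ρi≤ρj
  ... | true  = ≤∧≢⇒< (≤ᵇ⇒≤ (ρ i) (ρ j) (≡⇒T ρi≤ρj)) (<⇒≢ i<j ∘ injective P i< j<)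
    where i< = <-trans i<j j<
  ... | false = contradiction (sorts x ∣x∣ i<j j<) (subst₂ (λ u v → ¬ u ≤B v) (sym xρi) (sym xρj) λ ())
    where
    x = threshold (ρ i)
    ∣x∣ = length-applyUpTo (ρ i ≤ᵇ_) m
    fixed : run E x ≡ x
    fixed = run-standard-sorted stdE (sorted-threshold (ρ i))
    xρi : lookupD (run E x) (ρ i) ≡ true
    xρi rewrite fixed | lookup-threshold (ρ i) (mapsTo P (<-trans i<j j<)) = T⇒≡ (≤⇒≤ᵇ (≤-refl {ρ i}))
    xρj : lookupD (run E x) (ρ j) ≡ false
    xρj rewrite fixed | lookup-threshold (ρ i) (mapsTo P j<) = ρi≤ρj

  completion-empty : ∀ {E} → Standard E → Completion E [] → Sorts E
  completion-empty {E} stdE c x ∣x∣ = sorted-resp-≈ (λ k< → cong (lookupD (run E x)) (ρ≡id k<)) (sorts c x ∣x∣)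
    where ρ≡id = increasing⇒id (mapsTo (ρ-injective c)) (relabelling-increasing stdE (ρ-injective c) (sorts c))

  -- Generate and prune

  standard-stdPairs : All StandardComparator (stdPairs m)
  standard-stdPairs =
    concat⁺ (map⁺ (All.map (λ j< → map⁺ (All.map (_, j<) (all-upTo _))) (all-upTo m)))

  standard-OGenerate : ∀ {R} → All Standard R → All Standard (OGenerate R m)
  standard-OGenerate stdR =
    concat⁺ (map⁺ (All.map (λ stdC → map⁺ (filter⁺ _ (All.map (λ c → ++⁺ stdC (c ∷ [])) standard-stdPairs)))
                           stdR))

  ∈-OGenerate : ∀ {R E a b} → E ∈ R → a < b → b < m → T (not (redundantB m E (a , b))) →
                E ++ [ (a , b) ] ∈ OGenerate R m
  ∈-OGenerate E∈ a<b b< irredundant =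
    ∈-concat⁺′ (∈-map⁺ _ (∈-filter⁺ _ (∈-concat⁺′ (∈-map⁺ _ (∈-upTo⁺ a<b)) (∈-map⁺ _ (∈-upTo⁺ b<))) irredundant))
               (∈-map⁺ _ E∈)

  module Extension {R} (stdR : All Standard R) (unsortedR : ∀ {E} → E ∈ R → ¬ Sorts E) where

    Extension : ℕ → Set
    Extension n = ∃₂ λ E′ D′ → E′ ∈ OGenerate R m × Completion E′ D′ × size D′ < n

    extend-ordered : ∀ {E a b D} → a < b → E ∈ R → Completion E ((a , b) ∷ D) →
                     (Completion E D → Extension (size D)) → Extension (suc (size D))
    extend-ordered {E} {a} {b} a<b E∈ c@record { onChannels = (_ , b< , _) ∷ _ } extend-tail
      with redundantB m E (a , b) in redundant
    ... | true  with E′ , D′ , E′∈ , c′ , D′< ← extend-tail (completion-dropRedundant (≡⇒T redundant) c) =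
      E′ , D′ , E′∈ , c′ , m<n⇒m<1+n D′<
    ... | false =
      E ++ [ (a , b) ] , _ , ∈-OGenerate E∈ a<b b< (Equivalence.from T-not-≡ redundant) ,
      completion-shift c , n<1+n _

    -- Recursion is on size because flipping a comparator relabels the rest of the network.
    extend : ∀ {E D} → Acc _<_ (size D) → E ∈ R → Completion E D → Extension (size D)
    extend {E} {[]} _ E∈ c = ⊥-elim (unsortedR E∈ (completion-empty (All.lookup stdR E∈) c))
    extend {E} {(a , b) ∷ D} (acc rs) E∈ c@record { onChannels = (_ , _ , a≢b) ∷ _ } with <-cmp a b
    ... | tri< a<b _ _ = extend-ordered a<b E∈ c (extend (rs ≤-refl) E∈)
    ... | tri≈ _ a≡b _ = ⊥-elim (a≢b a≡b)
    ... | tri> _ _ b<a =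
      subst Extension (cong suc (size-relabel τ D))
        (extend-ordered b<a E∈ (completion-flip c)
          (extend (rs (s≤s (≤-reflexive (size-relabel τ D)))) E∈))
      where τ = transpose a b

  isPermB-sound : ∀ π → T (isPermB m π) → length π ≡ m × InjectiveBelow m (lookupℕ π)
  isPermB-sound π isPerm = ∣π∣≡m , record
    { mapsTo    = λ k< → <ᵇ⇒< _ m (All.lookup (all⁺ _ π bounded) (lookupℕ-∈ π (<-len k<)))
    ; injective = λ i< j< → distinctB-sound π distinct (<-len i<) (<-len j<)
    }
    where
    ∣π∣≡m : length π ≡ m
    ∣π∣≡m = ≡ᵇ⇒≡ _ m (proj₁ (Equivalence.to (T-∧ {length π ≡ᵇ m}) isPerm))
    bounded×distinct : T (all (_<ᵇ m) π) × T (distinctB π)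
    bounded×distinct = Equivalence.to T-∧ (proj₂ (Equivalence.to (T-∧ {length π ≡ᵇ m}) isPerm))
    bounded  = proj₁ bounded×distinct
    distinct = proj₂ bounded×distinct
    <-len : ∀ {k} → k < m → k < length π
    <-len = subst (_ <_) (sym ∣π∣≡m)

  leqπB-sound : ∀ π C C′ → T (leqπB m π C C′) → ∀ x → length x ≡ m →
                ∃ λ x′ → length x′ ≡ m × permute π (run C x) ≡ run C′ x′
  leqπB-sound π C C′ leq x ∣x∣
    with z , z∈ , eq ← find (any⁻ _ _ (All.lookup (all⁺ _ (outputs m C) leq) (run-∈-outputs C x ∣x∣)))
    with x′ , ∣x′∣ , refl ← ∈-outputs m C′ z∈ = x′ , ∣x′∣ , does-sound (≡-dec _≟B_ (permute π (run C x)) (run C′ x′)) eq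

  lookup-inverse : ∀ {π y} (π-inj : InjectiveBelow m (lookupℕ π)) → length π ≡ m → length y ≡ m →
                   lookupD y ∘ inverse π-inj ≈ lookupD (permute π y)
  lookup-inverse {π} {y} π-inj ∣π∣ ∣y∣ {i} i< = begin
    lookupD y (inverse π-inj i)                           ≡⟨ lookup-permute π y (trans ∣π∣ (sym ∣y∣))
                                                               (λ i< j< → injective π-inj (<-m i<) (<-m j<))
                                                               (subst (_ <_) (sym ∣y∣) ∘ mapsTo π-inj ∘ <-m)
                                                               (subst (inverse π-inj i <_) (sym ∣π∣) (proj₁ σi)) ⟨
    lookupD (permute π y) (lookupℕ π (inverse π-inj i))   ≡⟨ cong (lookupD (permute π y)) (proj₂ σi) ⟩
    lookupD (permute π y) i                               ∎
    where
    open ≡-Reasoning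
    σi = inverse-spec π-inj i<
    <-m : ∀ {k} → k < length π → k < m
    <-m = subst (_ <_) ∣π∣

  completion-oracle : ∀ {π C C′ D} → T (isPermB m π) → T (leqπB m π C C′) → Completion C′ D →
                      ∃ λ D′ → size D′ ≡ size D × Completion C D′
  completion-oracle {π} {C} {C′} {D} isPerm leq c =
    relabel σ D , size-relabel σ D , record
      { onChannels  = onChannels-relabel σ-inj (onChannels c)
      ; ρ           = σ ∘ ρ c
      ; ρ-injective = ∘-injectiveBelow σ-inj (ρ-injective c)
      ; sorts       = sorts′
      }
    where
    ∣π∣   = proj₁ (isPermB-sound π isPerm)
    π-inj = proj₂ (isPermB-sound π isPerm)
    σ     = inverse π-inj
    σ-inj = inverse-injectiveBelow π-inj
    sorts′ : ∀ x → length x ≡ m → Sorted (runᶠ (relabel σ D) (lookupD (run C x)) ∘ σ ∘ ρ c)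
    sorts′ x ∣x∣ with x′ , ∣x′∣ , eq ← leqπB-sound π C C′ leq x ∣x∣ = sorted-resp-≈
      (λ k< → let ρk< = mapsTo (ρ-injective c) k< in sym (trans
        (runᶠ-relabel _ σ-inj (onChannels c) ρk<)
        (runᶠ-cong (onChannels c)
          (λ i< → trans (lookup-inverse {π} {run C x} π-inj ∣π∣ (trans (length-run C x) ∣x∣) i<) (cong (λ y → lookupD y _) eq))
          ρk<)))
      (sorts c x′ ∣x′∣)

  elemN-sound : ∀ {C} G → T (elemN C G) → C ∈ G
  elemN-sound {C} G elem = Any.map (does-sound (C ≟N _)) (any⁻ _ G elem)

  ∈-removeN : ∀ {C C′ G} → C ∈ G → C ≢ C′ → C ∈ removeN C′ G
  ∈-removeN {C′ = C′} C∈ C≢C′ = ∈-filter⁺ (λ D → ¬? (D ≟N C′)) C∈ C≢C′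

  prune-⊆ : ∀ X G {E} → E ∈ Prune X G m → E ∈ G
  prune-⊆ []                 G E∈ = E∈
  prune-⊆ ((C , C′ , π) ∷ X) G E∈
    with (C ==N C′) ∨ not (elemN C G) ∨ not (isPermB m π) ∨ not (leqπB m π C C′)
  ... | true  = E∈
  ... | false = proj₁ (∈-filter⁻ (λ D → ¬? (D ≟N C′)) (prune-⊆ X (removeN C′ G) E∈))

  -- An entry (C , C′ , π) removes C′ only when C stays, and C ≤_π C′ lets C inherit the completions of C′.
  prune-complete : ∀ X G {E D} → E ∈ G → Completion E D →
                   ∃₂ λ E′ D′ → E′ ∈ Prune X G m × Completion E′ D′ × size D′ ≡ size D
  prune-complete [] G {E} {D} E∈ c = E , D , E∈ , c , refl
  prune-complete ((C , C′ , π) ∷ X) G {E} {D} E∈ c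
    with (C ==N C′) ∨ not (elemN C G) ∨ not (isPermB m π) ∨ not (leqπB m π C C′) in rejected
  ... | true  = E , D , E∈ , c , refl
  ... | false
    with C≢C′ , elem , isPerm , leq ← ∨-not-≡false (C ==N C′) (elemN C G) (isPermB m π) (leqπB m π C C′) rejected
    with E ≟N C′
  ...   | no′ E≢C′    = prune-complete X (removeN C′ G) (∈-removeN E∈ E≢C′) c
  ...   | yes′ refl
    with D′ , ∣D′∣ , c′ ← completion-oracle {π} isPerm leq c
    with E″ , D″ , E″∈ , c″ , ∣D″∣ ← prune-complete X (removeN E G)
           (∈-removeN (elemN-sound G elem) (not-does-sound (C ≟N E) C≢C′)) c′ =
    E″ , D″ , E″∈ , c″ , trans ∣D″∣ ∣D′∣

  onChannelsB-standard : ∀ {E} → Standard E → T (onChannelsB m E)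
  onChannelsB-standard stdE = all⁻ _ (All.map (λ { {i , j} (i<j , j<) → onChannel i<j j< }) stdE)
    where
    onChannel : ∀ {i j} → i < j → j < m → T ((i <ᵇ m) ∧ (j <ᵇ m) ∧ not (i ≡ᵇ j))
    onChannel {i} {j} i<j j< = Equivalence.from T-∧ (<⇒<ᵇ (<-trans i<j j<) ,
      Equivalence.from T-∧ (<⇒<ᵇ j< , T-not (<⇒≢ i<j ∘ ≡ᵇ⇒≡ i j)))

  sortedB-complete : ∀ y → (∀ {i j} → i < j → j < length y → lookupD y i ≤B lookupD y j) → T (sortedB y)
  sortedB-complete []           _      = _
  sortedB-complete (a ∷ [])     _      = _
  sortedB-complete (a ∷ b ∷ ys) sorted = Equivalence.from T-∧
    (≡⇒T (≤B⇒leqB (sorted {0} {1} z<s (s≤s (s≤s z≤n)))) ,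
     sortedB-complete (b ∷ ys) (λ i<j j< → sorted (s≤s i<j) (s≤s j<)))

  sortingB-complete : ∀ {E} → Standard E → Sorts E → T (sortingB m E)
  sortingB-complete {E} stdE sortsE =
    Equivalence.from T-∧ (onChannelsB-standard stdE , all⁻ _ (All.tabulate sortedOut))
    where
    sortedOut : ∀ {y} → y ∈ outputs m E → T (sortedB y)
    sortedOut y∈ with x , ∣x∣ , refl ← ∈-outputs m E y∈ =
      sortedB-complete (run E x) λ i<j j< → sortsE x ∣x∣ i<j (subst (_ <_) (trans (length-run E x) ∣x∣) j<)

  record Invariant (q : ℕ) (R : List Network) : Set where
    field
      standard : All Standard R
      unsorted : ∀ {E} → E ∈ R → ¬ Sorts E
      complete : ∀ {C} → SortingNetwork m C → ∃₂ λ E D → E ∈ R × Completion E D × q + size D ≤ size C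

    bound : ∀ {C} → SortingNetwork m C → q < size C
    bound sortingC with complete sortingC
    ... | E , []    , E∈ , c , _ = ⊥-elim (unsorted E∈ (completion-empty (All.lookup standard E∈) c))
    ... | E , _ ∷ _ , E∈ , c , q+∣D∣≤ = <-≤-trans (m<m+n _ z<s) q+∣D∣≤

  invariant-start : ∀ {m′} → m ≡ suc (suc m′) → Invariant 0 ([] ∷ [])
  invariant-start {m′} refl = record
    { standard = [] ∷ []
    ; unsorted = λ { (here refl) sorts → unsorted-input (sorts (true ∷ false ∷ replicate m′ false)
                                             (cong (suc ∘ suc) (length-replicate m′)) z<s (s≤s (s≤s z≤n))) }
    ; complete = λ sortingC → [] , _ , here refl , sortingNetwork-completion sortingC , ≤-refl
    }
    where unsorted-input : ¬ true ≤B false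
          unsorted-input ()

  invariant-step : ∀ {q R} X → Invariant q R → ¬ T (any (sortingB m) (Prune X (OGenerate R m) m)) →
                   Invariant (suc q) (Prune X (OGenerate R m) m)
  invariant-step {q} {R} X inv noneSorting = record
    { standard = standard′
    ; unsorted = λ E∈ sortsE → noneSorting (any⁺ _ (lose E∈ (sortingB-complete (All.lookup standard′ E∈) sortsE)))
    ; complete = complete′
    }
    where
    open Invariant inv
    open Extension standard unsorted
    standard′ : All Standard (Prune X (OGenerate R m) m)
    standard′ = All.tabulate (All.lookup (standard-OGenerate standard) ∘ prune-⊆ X (OGenerate R m))
    complete′ : ∀ {C} → SortingNetwork m C →
                ∃₂ λ E D → E ∈ Prune X (OGenerate R m) m × Completion E D × suc q + size D ≤ size C
    complete′ {C} sortingC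
      with E , D , E∈ , c , q+∣D∣≤ ← complete sortingC
      with E′ , D′ , E′∈ , c′ , ∣D′∣< ← extend (<-wellFounded (size D)) E∈ c
      with E″ , D″ , E″∈ , c″ , ∣D″∣≡ ← prune-complete X (OGenerate R m) E′∈ c′ =
      E″ , D″ , E″∈ , c″ , (begin
        suc q + size D″    ≡⟨ cong (suc q +_) ∣D″∣≡ ⟩
        suc q + size D′    ≡⟨ +-suc q (size D′) ⟨
        q + suc (size D′)  ≤⟨ +-monoʳ-≤ q ∣D′∣< ⟩
        q + size D         ≤⟨ q+∣D∣≤ ⟩
        size C             ∎)
      where open ≤-Reasoning

open Networks using (Invariant; invariant-start; invariant-step)

GP-nil : ∀ m n → GP m (suc n) [] ≡ maybe
GP-nil zero          n = refl
GP-nil (suc zero)    n = refl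
GP-nil (suc (suc m)) n = refl

GP-cons : ∀ m n X O → GP m (suc n) (X ∷ O) ≡ step X (GP m n O)
GP-cons zero          n X O = refl
GP-cons (suc zero)    n X O = refl
GP-cons (suc (suc m)) n X O = refl

GP-no⇒invariant : ∀ m n O {p q R} → GP m n O ≡ no p q R → p ≡ m × q ≡ n × Invariant m n R
GP-no⇒invariant (suc (suc m)) zero    O       refl = refl , refl , invariant-start _ refl
GP-no⇒invariant m             (suc n) []      gp with () ← trans (sym (GP-nil m n)) gp
GP-no⇒invariant m             (suc n) (X ∷ O) gp with GP m n O in gpₙ | trans (sym (GP-cons m n X O)) gp
... | no _ _ R | gp′ with refl , refl , inv ← GP-no⇒invariant m n O gpₙ
    with any (sortingB m) (Prune X (OGenerate R m) m) in found | gp′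
... | false | refl = refl , refl , invariant-step m X inv (subst T found)

mainTheorem7 : (m n : ℕ) (O : List Oracle) (R : List Network) →
               GP m n O ≡ no m n R →
               (C : Network) → SortingNetwork m C → n < size C
mainTheorem7 m n O R gp C sortingC = Invariant.bound (proj₂ (proj₂ (GP-no⇒invariant m n O gp))) sortingC
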